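{- Let $\Gamma=\mathrm{Dic}(n,R,T)$ be a distance-regular dicirculant with valency $k$, let $\lambda$ be the number of common neighbours of two adjacent vertices and $\mu$ the number of common neighbours of two vertices at distance $2$. For $j\ge 0$ let $R_j=\{i\in\mathbb{Z}_{2n}:\partial(1,\alpha^i)=j\}$ and $T_j=\{i\in\mathbb{Z}_{2n}:\partial(1,\alpha^i\beta)=j\}$ (so $R_1=R$, $T_1=T$), let $\omega=e^{\pi\mathbf{i}/n}$, and define functions $\mathbb{Z}_{2n}\to\mathbb{C}$ by $\underline{\mathbf{r}}_j(z)=\sum_{i\in R_j}\omega^{iz}$, $\underline{\mathbf{t}}_j(z)=\sum_{i\in T_j}\omega^{iz}$, $\underline{\mathbf{r}}=\underline{\mathbf{r}}_1$, $\underline{\mathbf{t}}=\underline{\mathbf{t}}_1$. Then for every $z\in\mathbb{Z}_{2n}$, $$\underline{\mathbf{r}}(z)^2+|\underline{\mathbf{t}}(z)|^2=k+\lambda\,\underline{\mathbf{r}}(z)+\mu\,\underline{\mathbf{r}}_2(z)\quad\text{and}\quad 2\,\underline{\mathbf{r}}(z)\underline{\mathbf{t}}(z)=\lambda\,\underline{\mathbf{t}}(z)+\mu\,\underline{\mathbf{t}}_2(z).$$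
   Context: $\mathrm{Dic}_n=\langle \alpha,\beta \mid \alpha^{2n}=1,\ \beta^2=\alpha^n,\ \beta^{ -1}\alpha\beta=\alpha^{ -1}\rangle$, with identity $1$. For $R,T\subseteq\mathbb{Z}_{2n}$ with $0\notin R$, $R=-R$, $T=n+T$, $\mathrm{Dic}(n,R,T)$ is the Cayley graph $\mathrm{Cay}(\mathrm{Dic}_n,\alpha^R\cup\alpha^T\beta)$ with vertex set $\mathrm{Dic}_n$ and $g\sim h$ iff $g^{ -1}h\in\alpha^R\cup\alpha^T\beta$, where $\alpha^A=\{\alpha^a:a\in A\}$, $\alpha^A\beta=\{\alpha^a\beta:a\in A\}$; $\partial$ denotes graph distance. Distance-regular: connected, and for vertices $u,v$ at distance $i$ the numbers of neighbours of $v$ at distance $i-1,i,i+1$ from $u$ depend only on $i$. (If the diameter is $1$, then $R_2=T_2=\emptyset$ and the terms involving $\mu$ vanish.) -}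

module Defs where

open import Level using (Level)
open import Data.Nat using (ℕ; zero; suc; _∸_; _<_; NonZero)
import Data.Nat as ℕ
open import Data.Nat.Properties using (m*n≢0)
open import Data.Nat.DivMod using (_mod_)
open import Data.Fin using (Fin; toℕ) renaming (zero to fzero; suc to fsuc)
import Data.Fin as F
open import Data.Fin.Subset using (Subset)
open import Data.Vec using (lookup)
open import Data.Bool using (Bool; true; false; _∧_; _∨_; not; if_then_else_)
import Data.Bool as B
open import Data.Product using (_×_; _,_; ∃)
open import Relation.Nullary.Decidable using (⌊_⌋)
open import Relation.Binary.PropositionalEquality using (_≡_)
open import Algebra.Bundles using (CommutativeRing)

module _ (n : ℕ) .{{_ : NonZero n}} where
  private instance
    nz2n : NonZero (2 ℕ.* n)
    nz2n = m*n≢0 2 n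

  Zm : Set
  Zm = Fin (2 ℕ.* n)

  _⊕_ : Zm → Zm → Zm
  a ⊕ b = (toℕ a ℕ.+ toℕ b) mod (2 ℕ.* n)

  ⊖_ : Zm → Zm
  ⊖ a = (2 ℕ.* n ∸ toℕ a) mod (2 ℕ.* n)

  _⊝_ : Zm → Zm → Zm
  a ⊝ b = a ⊕ (⊖ b)

  0ᶻ : Zm
  0ᶻ = 0 mod (2 ℕ.* n)

  nᶻ : Zm
  nᶻ = n mod (2 ℕ.* n)

  -- The dicyclic group Dic_n: the pair (a , b) stands for α^a β^b
  -- (b = false : β^0, b = true : β^1).

  Dic : Set
  Dic = Zm × Bool

  e : Dic
  e = (0ᶻ , false)

  -- multiplication, from α^{2n}=1, β^2=α^n, β⁻¹αβ=α⁻¹ (so β α^c = α^{-c} β)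
  _·_ : Dic → Dic → Dic
  (a , false) · (c , d)     = (a ⊕ c , d)
  (a , true)  · (c , false) = (a ⊝ c , true)
  (a , true)  · (c , true)  = ((a ⊝ c) ⊕ nᶻ , false)

  inv : Dic → Dic
  inv (a , false) = (⊖ a , false)
  inv (a , true)  = (a ⊕ nᶻ , true)

  _==_ : Dic → Dic → Bool
  (a , b) == (c , d) = ⌊ a F.≟ c ⌋ ∧ ⌊ b B.≟ d ⌋

  anyFin : ∀ {m} → (Fin m → Bool) → Bool
  anyFin {zero}  f = false
  anyFin {suc m} f = f fzero ∨ anyFin (λ i → f (fsuc i))

  countFin : ∀ {m} → (Fin m → Bool) → ℕ
  countFin {zero}  f = 0
  countFin {suc m} f = (if f fzero then 1 else 0) ℕ.+ countFin (λ i → f (fsuc i))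

  anyDic : (Dic → Bool) → Bool
  anyDic P = anyFin (λ a → P (a , false) ∨ P (a , true))

  countDic : (Dic → Bool) → ℕ
  countDic P = countFin (λ a → P (a , false)) ℕ.+ countFin (λ a → P (a , true))

  -- The Cayley graph Dic(n,R,T) = Cay(Dic_n, α^R ∪ α^T β):
  -- g ∼ h iff g⁻¹h ∈ α^R ∪ α^T β.

  module _ (R T : Subset (2 ℕ.* n)) where

    inS : Dic → Bool
    inS (a , false) = lookup R a
    inS (a , true)  = lookup T a

    adj : Dic → Dic → Bool
    adj g h = inS (inv g · h)

    within : ℕ → Dic → Dic → Bool
    within zero    g h = g == h
    within (suc j) g h = within j g h ∨ anyDic (λ x → adj g x ∧ within j x h)

    distIs : Dic → Dic → ℕ → Bool
    distIs g h zero    = g == h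
    distIs g h (suc j) = within (suc j) g h ∧ not (within j g h)

    Dist : Dic → Dic → ℕ → Set
    Dist g h j = distIs g h j ≡ true

    Connected : Set
    Connected = ∀ g h → ∃ λ j → within j g h ≡ true

    nbrsAt : Dic → Dic → ℕ → ℕ
    nbrsAt u v j = countDic (λ x → adj v x ∧ distIs u x j)

    DistanceRegular : Set
    DistanceRegular =
      Connected ×
      (∀ i u v u′ v′ → Dist u v i → Dist u′ v′ i →
         ∀ j → (j ≡ i ∸ 1 × 1 Data.Nat.≤ i) ⊎′ (j ≡ i) ⊎′ (j ≡ suc i) →
         nbrsAt u v j ≡ nbrsAt u′ v′ j)
      where open import Data.Sum using () renaming (_⊎_ to _⊎′_)

    commonNbrs : Dic → Dic → ℕ
    commonNbrs u v = countDic (λ x → adj u x ∧ adj v x)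

    inRj : ℕ → Zm → Bool
    inRj j i = distIs e (i , false) j

    inTj : ℕ → Zm → Bool
    inTj j i = distIs e (i , true) j

module RingOps {c ℓ : Level} (A : CommutativeRing c ℓ) where
  open CommutativeRing A

  pow : Carrier → ℕ → Carrier
  pow x zero    = 1#
  pow x (suc m) = x * pow x m

  ι : ℕ → Carrier
  ι zero    = 0#
  ι (suc m) = 1# + ι m

  ∑ : ∀ {m} → (Fin m → Carrier) → Carrier
  ∑ {zero}  f = 0#
  ∑ {suc m} f = f fzero + ∑ (λ i → f (fsuc i))

  PrimitiveRoot : (N : ℕ) → Carrier → Set ℓ
  PrimitiveRoot N ω = (pow ω N ≈ 1#) × (∀ j → 0 < j → j < N → ¬′ (pow ω j ≈ 1#))
    where open import Relation.Nullary using () renaming (¬_ to ¬′_)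

  -- cj behaves as complex conjugation: an involutive ring endomorphism
  -- with cj ω = ω⁻¹
  record IsConj (ω : Carrier) (cj : Carrier → Carrier) : Set (c Level.⊔ ℓ) where
    field
      cong-cj : ∀ {x y} → x ≈ y → cj x ≈ cj y
      cj-+    : ∀ x y → cj (x + y) ≈ cj x + cj y
      cj-*    : ∀ x y → cj (x * y) ≈ cj x * cj y
      cj-1    : cj 1# ≈ 1#
      cj-inv  : ∀ x → cj (cj x) ≈ x
      cj-ω    : cj ω * ω ≈ 1#

  module _ (n : ℕ) .{{_ : NonZero n}} (R T : Subset (2 ℕ.* n)) (ω : Carrier) where
    rf : ℕ → Zm n → Carrier
    rf j z = ∑ (λ i → if inRj n R T j i then pow ω (toℕ i ℕ.* toℕ z) else 0#)

    tf : ℕ → Zm n → Carrier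
    tf j z = ∑ (λ i → if inTj n R T j i then pow ω (toℕ i ℕ.* toℕ z) else 0#)

-- Count the common neighbours of 1 and g in two ways. As S = α^R ∪ α^T β is closed under
-- inversion, they correspond to the factorisations g = s s′ with s, s′ ∈ S; on the other
-- hand, by the definition of k, λ and μ, there are k[g = 1] + λ[g ∼ 1] + μ[∂(1,g) = 2] of
-- them. Weight both counts by the character χ(c) = ω^{cz} and sum over g = α^c β^ε, c ∈ ℤ_{2n}.
-- Fix the first factor s = α^a β^δ. Then s⁻¹g is α^{±(c−a)} times a power of β, so the sum
-- over c is a character sum of R or T translated by a, i.e. r χ(a) or t χ(a), except when
-- δ = 1 and ε = 0: there s⁻¹g = α^{a−c}β and the reflection c ↦ a − c gives χ(a) t̄.
-- Summing over s yields r² + t t̄ for ε = 0 and 2rt for ε = 1, while the weighted count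
-- yields k + λ r + μ r₂ and λ t + μ t₂.
module Submission where

open import Defs
open import Level using (Level; 0ℓ)
open import Data.Nat using (ℕ; zero; suc; NonZero; _∸_; _%_)
import Data.Nat
import Data.Nat as ℕ
import Data.Nat.Properties as ℕₚ
open ℕₚ using (m*n≢0; m+[n∸m]≡n; <⇒≤)
open import Data.Nat.DivMod
  using (_mod_; _/_; m≡m%n+[m/n]*n; %-distribˡ-+; %-distribˡ-*; m%n%n≡m%n; m<n⇒m%n≡m; n%n≡0; m*n%n≡0)
open import Data.Fin using (Fin; toℕ) renaming (zero to fzero; suc to fsuc)
import Data.Fin as F
open import Data.Fin.Properties using (toℕ-injective; toℕ<n; toℕ-fromℕ<)
open import Data.Fin.Subset using (Subset)
open import Data.Vec using (lookup)
open import Data.Bool using (Bool; true; false; _∧_; _∨_; not; if_then_else_)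
import Data.Bool as B
open import Data.Bool.Properties
  using (∧-conicalˡ; ∧-conicalʳ; ∧-identityʳ; ∧-zeroʳ; ∧-idem; ∨-zeroʳ; ∨-conicalˡ; ∨-conicalʳ)
open import Data.Bool.Properties using (not-injective; ¬-not; ⇔→≡)
open import Data.Product using (_,_; ∃; _×_; proj₁; proj₂)
import Data.Product as Product
open import Function using (_∘_; id; mk⇔)
open import Relation.Nullary using (Dec; yes; no; contradiction)
open import Relation.Nullary.Decidable using (⌊_⌋; dec-true; isYes≗does)
open import Relation.Binary.PropositionalEquality as ≡ using (_≡_)
open import Algebra.Bundles using (AbelianGroup; CommutativeRing)

[m%d+n]%d≡[m+n]%d : ∀ m n d .{{_ : NonZero d}} → (m % d ℕ.+ n) % d ≡ (m ℕ.+ n) % d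
[m%d+n]%d≡[m+n]%d m n d = begin
  (m % d ℕ.+ n) % d           ≡⟨ %-distribˡ-+ (m % d) n d ⟩
  (m % d % d ℕ.+ n % d) % d   ≡⟨ ≡.cong (λ u → (u ℕ.+ n % d) % d) (m%n%n≡m%n m d) ⟩
  (m % d ℕ.+ n % d) % d       ≡⟨ %-distribˡ-+ m n d ⟨
  (m ℕ.+ n) % d               ∎
  where open ≡.≡-Reasoning

[m+n%d]%d≡[m+n]%d : ∀ m n d .{{_ : NonZero d}} → (m ℕ.+ n % d) % d ≡ (m ℕ.+ n) % d
[m+n%d]%d≡[m+n]%d m n d = begin
  (m ℕ.+ n % d) % d   ≡⟨ ≡.cong (_% d) (ℕₚ.+-comm m (n % d)) ⟩
  (n % d ℕ.+ m) % d   ≡⟨ [m%d+n]%d≡[m+n]%d n m d ⟩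
  (n ℕ.+ m) % d       ≡⟨ ≡.cong (_% d) (ℕₚ.+-comm n m) ⟩
  (m ℕ.+ n) % d       ∎
  where open ≡.≡-Reasoning

[m%d*n]%d≡[m*n]%d : ∀ m n d .{{_ : NonZero d}} → (m % d ℕ.* n) % d ≡ (m ℕ.* n) % d
[m%d*n]%d≡[m*n]%d m n d = begin
  (m % d ℕ.* n) % d               ≡⟨ %-distribˡ-* (m % d) n d ⟩
  (m % d % d ℕ.* (n % d)) % d     ≡⟨ ≡.cong (λ u → (u ℕ.* (n % d)) % d) (m%n%n≡m%n m d) ⟩
  (m % d ℕ.* (n % d)) % d         ≡⟨ %-distribˡ-* m n d ⟨
  (m ℕ.* n) % d                   ∎
  where open ≡.≡-Reasoning

toℕ-mod : ∀ m d .{{_ : NonZero d}} → toℕ (m mod d) ≡ m % d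
toℕ-mod m d = toℕ-fromℕ< _

mod-cong : ∀ {m m′} d .{{_ : NonZero d}} → m % d ≡ m′ % d → m mod d ≡ m′ mod d
mod-cong d eq = toℕ-injective (≡.trans (toℕ-mod _ d) (≡.trans eq (≡.sym (toℕ-mod _ d))))

toℕ-mod-id : ∀ {d} .{{_ : NonZero d}} (i : Fin d) → toℕ i mod d ≡ i
toℕ-mod-id {d} i = toℕ-injective (≡.trans (toℕ-mod _ d) (m<n⇒m%n≡m (toℕ<n i)))

module ℤ-Mod (n : ℕ) .{{_ : NonZero n}} where

  open Data.Nat using (_+_)
  open ≡ using (refl; sym; trans; cong; cong₂; isEquivalence; module ≡-Reasoning)

  N : ℕ
  N = 2 ℕ.* n

  instance
    N≢0 : NonZero N
    N≢0 = m*n≢0 2 n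

  _⊕′_ : Zm n → Zm n → Zm n
  _⊕′_ = _⊕_ n

  ⊖′_ : Zm n → Zm n
  ⊖′_ = ⊖_ n

  _⊝′_ : Zm n → Zm n → Zm n
  _⊝′_ = _⊝_ n

  toℕ-0ᶻ : toℕ (0ᶻ n) ≡ 0
  toℕ-0ᶻ = trans (toℕ-mod 0 N) (m*n%n≡0 0 N)

  ⊕-comm : ∀ a b → a ⊕′ b ≡ b ⊕′ a
  ⊕-comm a b = cong (_mod N) (ℕₚ.+-comm (toℕ a) (toℕ b))

  ⊕-assoc : ∀ a b c → (a ⊕′ b) ⊕′ c ≡ a ⊕′ (b ⊕′ c)
  ⊕-assoc a b c = mod-cong N (begin
    (toℕ (a ⊕′ b) + toℕ c) % N               ≡⟨ cong (λ u → (u + toℕ c) % N) (toℕ-mod _ N) ⟩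
    ((toℕ a + toℕ b) % N + toℕ c) % N        ≡⟨ [m%d+n]%d≡[m+n]%d _ _ N ⟩
    (toℕ a + toℕ b + toℕ c) % N              ≡⟨ cong (_% N) (ℕₚ.+-assoc (toℕ a) _ _) ⟩
    (toℕ a + (toℕ b + toℕ c)) % N            ≡⟨ [m+n%d]%d≡[m+n]%d _ _ N ⟨
    (toℕ a + (toℕ b + toℕ c) % N) % N        ≡⟨ cong (λ u → (toℕ a + u) % N) (toℕ-mod _ N) ⟨
    (toℕ a + toℕ (b ⊕′ c)) % N               ∎)
    where open ≡-Reasoning

  ⊕-identityˡ : ∀ a → 0ᶻ n ⊕′ a ≡ a
  ⊕-identityˡ a = trans (cong (λ u → (u + toℕ a) mod N) toℕ-0ᶻ) (toℕ-mod-id a)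

  ⊖-inverseʳ : ∀ a → a ⊕′ (⊖′ a) ≡ 0ᶻ n
  ⊖-inverseʳ a = mod-cong N (begin
    (toℕ a + toℕ (⊖′ a)) % N       ≡⟨ cong (λ u → (toℕ a + u) % N) (toℕ-mod _ N) ⟩
    (toℕ a + (N ∸ toℕ a) % N) % N  ≡⟨ [m+n%d]%d≡[m+n]%d _ _ N ⟩
    (toℕ a + (N ∸ toℕ a)) % N      ≡⟨ cong (_% N) (m+[n∸m]≡n (<⇒≤ (toℕ<n a))) ⟩
    N % N                          ≡⟨ n%n≡0 N ⟩
    0                              ≡⟨ m*n%n≡0 0 N ⟨
    0 % N                          ∎)
    where open ≡-Reasoning

  nᶻ⊕nᶻ≡0ᶻ : nᶻ n ⊕′ nᶻ n ≡ 0ᶻ n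
  nᶻ⊕nᶻ≡0ᶻ = mod-cong N (begin
    (toℕ (nᶻ n) + toℕ (nᶻ n)) % N  ≡⟨ cong₂ (λ u v → (u + v) % N) (toℕ-mod n N) (toℕ-mod n N) ⟩
    (n % N + n % N) % N            ≡⟨ [m%d+n]%d≡[m+n]%d n (n % N) N ⟩
    (n + n % N) % N                ≡⟨ [m+n%d]%d≡[m+n]%d n n N ⟩
    (n + n) % N                    ≡⟨ cong (λ u → (n + u) % N) (sym (ℕₚ.+-identityʳ n)) ⟩
    N % N                          ≡⟨ n%n≡0 N ⟩
    0                              ≡⟨ m*n%n≡0 0 N ⟨
    0 % N                          ∎)
    where open ≡-Reasoning

  abelianGroup : AbelianGroup 0ℓ 0ℓ
  abelianGroup = record
    { Carrier = Zm n ; _≈_ = _≡_ ; _∙_ = _⊕′_ ; ε = 0ᶻ n ; _⁻¹ = ⊖′_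
    ; isAbelianGroup = record
      { isGroup = record
        { isMonoid = record
          { isSemigroup = record
            { isMagma = record { isEquivalence = isEquivalence ; ∙-cong = cong₂ _⊕′_ }
            ; assoc = ⊕-assoc }
          ; identity = ⊕-identityˡ , λ a → trans (⊕-comm a _) (⊕-identityˡ a) }
        ; inverse = (λ a → trans (⊕-comm _ a) (⊖-inverseʳ a)) , ⊖-inverseʳ
        ; ⁻¹-cong = cong ⊖′_ }
      ; comm = ⊕-comm } }

  open AbelianGroup abelianGroup using (identityʳ; commutativeMonoid)
  open import Algebra.Properties.AbelianGroup abelianGroup
    using (ε⁻¹≈ε; xyx⁻¹≈y)
  open import Algebra.Properties.AbelianGroup abelianGroup public
    using (⁻¹-anti-homo‿-; //-rightDividesˡ; //-rightDividesʳ)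
  open import Algebra.Solver.CommutativeMonoid commutativeMonoid using (solve; _⊜_)
    renaming (_⊕_ to _⊞_)

  ⊝-identityʳ : ∀ a → a ⊝′ 0ᶻ n ≡ a
  ⊝-identityʳ a = trans (cong (a ⊕′_) ε⁻¹≈ε) (identityʳ a)

  ⊝-⊝-cancel : ∀ a b → a ⊝′ (a ⊝′ b) ≡ b
  ⊝-⊝-cancel a b = begin
    a ⊕′ (⊖′ (a ⊝′ b))    ≡⟨ cong (a ⊕′_) (⁻¹-anti-homo‿- a b) ⟩
    a ⊕′ (b ⊝′ a)         ≡⟨ ⊕-assoc a b (⊖′ a) ⟨
    (a ⊕′ b) ⊝′ a         ≡⟨ xyx⁻¹≈y a b ⟩
    b                     ∎
    where open ≡-Reasoning

  ⊕nᶻ-⊝ : ∀ a b → (a ⊕′ nᶻ n) ⊝′ b ≡ nᶻ n ⊕′ (a ⊝′ b)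
  ⊕nᶻ-⊝ a b = solve 3 (λ a m b′ → ((a ⊞ m) ⊞ b′) ⊜ (m ⊞ (a ⊞ b′))) refl a (nᶻ n) (⊖′ b)

  ⊕nᶻ-⊝-⊕nᶻ : ∀ a b → ((a ⊕′ nᶻ n) ⊝′ b) ⊕′ nᶻ n ≡ a ⊝′ b
  ⊕nᶻ-⊝-⊕nᶻ a b = begin
    ((a ⊕′ nᶻ n) ⊝′ b) ⊕′ nᶻ n
      ≡⟨ solve 3 (λ a m b′ → (((a ⊞ m) ⊞ b′) ⊞ m) ⊜ ((a ⊞ b′) ⊞ (m ⊞ m))) refl a (nᶻ n) (⊖′ b) ⟩
    (a ⊝′ b) ⊕′ (nᶻ n ⊕′ nᶻ n)   ≡⟨ cong ((a ⊝′ b) ⊕′_) nᶻ⊕nᶻ≡0ᶻ ⟩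
    (a ⊝′ b) ⊕′ 0ᶻ n             ≡⟨ identityʳ _ ⟩
    a ⊝′ b                       ∎
    where open ≡-Reasoning

module DicEnumeration (n : ℕ) .{{_ : NonZero n}} where

  open Data.Nat using (_+_)
  open ≡ using (refl; trans; cong; cong₂)

  _==′_ : Dic n → Dic n → Bool
  _==′_ = _==_ n

  ==⇒≡ : ∀ {g h} → (g ==′ h) ≡ true → g ≡ h
  ==⇒≡ {a , b} {c , d} p = cong₂ _,_ (witness (a F.≟ c) (∧-conicalˡ _ _ p)) (witness (b B.≟ d) (∧-conicalʳ _ _ p))
    where
    witness : ∀ {A : Set} (a? : Dec A) → ⌊ a? ⌋ ≡ true → A
    witness (yes a) _ = a

  ==-refl : ∀ g → (g ==′ g) ≡ true
  ==-refl (a , b) = cong₂ _∧_ (holds (a F.≟ a) refl) (holds (b B.≟ b) refl)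
    where
    holds : ∀ {A : Set} (a? : Dec A) → A → ⌊ a? ⌋ ≡ true
    holds a? p = trans (isYes≗does a?) (dec-true a? p)

  anyFin-intro : ∀ {m} (f : Fin m → Bool) i → f i ≡ true → anyFin n f ≡ true
  anyFin-intro f fzero    p rewrite p = refl
  anyFin-intro f (fsuc i) p = trans (cong (f fzero ∨_) (anyFin-intro (f ∘ fsuc) i p)) (∨-zeroʳ _)

  anyFin-elim : ∀ {m} (f : Fin m → Bool) → anyFin n f ≡ true → ∃ λ i → f i ≡ true
  anyFin-elim {suc m} f p with f fzero in f0
  ... | true  = fzero , f0
  ... | false = Product.map fsuc id (anyFin-elim (f ∘ fsuc) p)

  anyDic-intro : (P : Dic n → Bool) → ∀ g → P g ≡ true → anyDic n P ≡ true
  anyDic-intro P (a , false) p = anyFin-intro _ a (cong (_∨ P (a , true)) p)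
  anyDic-intro P (a , true)  p = anyFin-intro _ a (trans (cong (P (a , false) ∨_) p) (∨-zeroʳ _))

  anyDic-elim : (P : Dic n → Bool) → anyDic n P ≡ true → ∃ λ g → P g ≡ true
  anyDic-elim P p with anyFin-elim _ p
  ... | a , q with P (a , false) in p₀
  ...   | true  = (a , false) , p₀
  ...   | false = (a , true) , q

  countFin-cong : ∀ {m} {f g : Fin m → Bool} → (∀ i → f i ≡ g i) → countFin n f ≡ countFin n g
  countFin-cong {zero}  f≗g = refl
  countFin-cong {suc m} f≗g = cong₂ (λ b c → (if b then 1 else 0) + c) (f≗g fzero) (countFin-cong (f≗g ∘ fsuc))

  countFin-false : ∀ {m} (f : Fin m → Bool) → (∀ i → f i ≡ false) → countFin n f ≡ 0
  countFin-false {zero}  f f≗0 = refl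
  countFin-false {suc m} f f≗0 rewrite f≗0 fzero = countFin-false (f ∘ fsuc) (f≗0 ∘ fsuc)

  countDic-cong : ∀ {P Q : Dic n → Bool} → (∀ g → P g ≡ Q g) → countDic n P ≡ countDic n Q
  countDic-cong P≗Q = cong₂ _+_ (countFin-cong (λ a → P≗Q (a , false))) (countFin-cong (λ a → P≗Q (a , true)))

  countDic-false : (P : Dic n → Bool) → (∀ g → P g ≡ false) → countDic n P ≡ 0
  countDic-false P P≗0 = cong₂ _+_ (countFin-false _ (λ a → P≗0 (a , false))) (countFin-false _ (λ a → P≗0 (a , true)))

module CayleyGraph (n : ℕ) .{{_ : NonZero n}} (R T : Subset (2 ℕ.* n))
  (0∉R : lookup R (0ᶻ n) ≡ false)
  (R-sym : ∀ i → lookup R (⊖_ n i) ≡ lookup R i)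
  (T-shift : ∀ i → lookup T (_⊕_ n (nᶻ n) i) ≡ lookup T i) where

  open ℤ-Mod n
  open DicEnumeration n
  open Data.Nat using (_+_)
  open ≡ using (refl; sym; trans; cong; cong₂; module ≡-Reasoning)

  1ᴰ : Dic n
  1ᴰ = e n

  _~_ : Dic n → Dic n → Bool
  _~_ = adj n R T

  within′ : ℕ → Dic n → Dic n → Bool
  within′ = within n R T

  distIs′ : Dic n → Dic n → ℕ → Bool
  distIs′ = distIs n R T

  R-swap : ∀ a b → lookup R (a ⊝′ b) ≡ lookup R (b ⊝′ a)
  R-swap a b = trans (sym (R-sym (a ⊝′ b))) (cong (lookup R) (⁻¹-anti-homo‿- a b))

  ~-ff : ∀ a c → (a , false) ~ (c , false) ≡ lookup R (c ⊝′ a)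
  ~-ff a c = cong (lookup R) (⊕-comm (⊖′ a) c)

  ~-ft : ∀ a c → (a , false) ~ (c , true) ≡ lookup T (c ⊝′ a)
  ~-ft a c = cong (lookup T) (⊕-comm (⊖′ a) c)

  ~-tf : ∀ a c → (a , true) ~ (c , false) ≡ lookup T (a ⊝′ c)
  ~-tf a c = trans (cong (lookup T) (⊕nᶻ-⊝ a c)) (T-shift (a ⊝′ c))

  ~-tt : ∀ a c → (a , true) ~ (c , true) ≡ lookup R (c ⊝′ a)
  ~-tt a c = trans (cong (lookup R) (⊕nᶻ-⊝-⊕nᶻ a c)) (R-swap a c)

  ~-sym : ∀ g h → g ~ h ≡ h ~ g
  ~-sym (a , false) (c , false) = trans (~-ff a c) (trans (R-swap c a) (sym (~-ff c a)))
  ~-sym (a , false) (c , true)  = trans (~-ft a c) (sym (~-tf c a))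
  ~-sym (a , true)  (c , false) = trans (~-tf a c) (sym (~-ft c a))
  ~-sym (a , true)  (c , true)  = trans (~-tt a c) (trans (R-swap c a) (sym (~-tt c a)))

  1ᴰ~-f : ∀ a → 1ᴰ ~ (a , false) ≡ lookup R a
  1ᴰ~-f a = trans (~-ff (0ᶻ n) a) (cong (lookup R) (⊝-identityʳ a))

  1ᴰ~-t : ∀ a → 1ᴰ ~ (a , true) ≡ lookup T a
  1ᴰ~-t a = trans (~-ft (0ᶻ n) a) (cong (lookup T) (⊝-identityʳ a))

  1ᴰ≁1ᴰ : 1ᴰ ~ 1ᴰ ≡ false
  1ᴰ≁1ᴰ = trans (1ᴰ~-f (0ᶻ n)) 0∉R

  within-1 : ∀ g h → within′ 1 g h ≡ (g ==′ h) ∨ g ~ h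
  within-1 g h = cong ((g ==′ h) ∨_) (⇔→≡ (mk⇔ to from))
    where
    to : anyDic n (λ x → g ~ x ∧ (x ==′ h)) ≡ true → g ~ h ≡ true
    to p with anyDic-elim (λ x → g ~ x ∧ (x ==′ h)) p
    ... | x , q with refl ← ==⇒≡ {x} {h} (∧-conicalʳ (g ~ x) _ q) = ∧-conicalˡ _ _ q
    from : g ~ h ≡ true → anyDic n (λ x → g ~ x ∧ (x ==′ h)) ≡ true
    from p = anyDic-intro (λ x → g ~ x ∧ (x ==′ h)) h (cong₂ _∧_ p (==-refl h))

  within-2-intro : ∀ g x h → g ~ x ≡ true → x ~ h ≡ true → within′ 2 g h ≡ true
  within-2-intro g x h g~x x~h =
    trans (cong (within′ 1 g h ∨_) (anyDic-intro (λ y → g ~ y ∧ within′ 1 y h) x step)) (∨-zeroʳ _)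
    where
    step : g ~ x ∧ within′ 1 x h ≡ true
    step = cong₂ _∧_ g~x (trans (within-1 x h) (trans (cong ((x ==′ h) ∨_) x~h) (∨-zeroʳ _)))

  distIs-1 : ∀ g → distIs′ 1ᴰ g 1 ≡ 1ᴰ ~ g
  distIs-1 g rewrite within-1 1ᴰ g with 1ᴰ ==′ g in e≡g
  ... | true  with refl ← ==⇒≡ {1ᴰ} {g} e≡g = sym 1ᴰ≁1ᴰ
  ... | false = ∧-identityʳ _

  distIs-2 : ∀ g h → distIs′ g h 2 ≡ within′ 2 g h ∧ not ((g ==′ h) ∨ g ~ h)
  distIs-2 g h = cong (λ b → within′ 2 g h ∧ not b) (within-1 g h)

  distIs-2-separated : ∀ g h → distIs′ g h 2 ≡ true → (g ==′ h) ≡ false × g ~ h ≡ false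
  distIs-2-separated g h d₂ = ∨-conicalˡ _ _ apart , ∨-conicalʳ _ _ apart
    where
    apart : (g ==′ h) ∨ g ~ h ≡ false
    apart = not-injective (∧-conicalʳ (within′ 2 g h) _ (trans (sym (distIs-2 g h)) d₂))

  common-neighbour⇒distIs-2 : ∀ g x → (1ᴰ ==′ g) ≡ false → 1ᴰ ~ g ≡ false →
                              1ᴰ ~ x ∧ g ~ x ≡ true → distIs′ 1ᴰ g 2 ≡ true
  common-neighbour⇒distIs-2 g x e≢g e≁g common = trans (distIs-2 1ᴰ g) (cong₂ (λ w b → w ∧ not b)
    (within-2-intro 1ᴰ x g (∧-conicalˡ _ _ common) (trans (~-sym x g) (∧-conicalʳ (1ᴰ ~ x) _ common)))
    (cong₂ _∨_ e≢g e≁g))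

  module _ (k lam mu : ℕ)
    (valency : countDic n (1ᴰ ~_) ≡ k)
    (λ-common : ∀ u v → u ~ v ≡ true → commonNbrs n R T u v ≡ lam)
    (μ-common : ∀ u v → Dist n R T u v 2 → commonNbrs n R T u v ≡ mu) where

    commonNbrs-1ᴰ : ∀ g → commonNbrs n R T 1ᴰ g ≡
      (if 1ᴰ ==′ g then k else 0) + (if 1ᴰ ~ g then lam else 0) + (if distIs′ 1ᴰ g 2 then mu else 0)
    commonNbrs-1ᴰ g = by-cases (1ᴰ ==′ g) (1ᴰ ~ g) (distIs′ 1ᴰ g 2) refl refl refl
      where
      by-cases : ∀ b₀ b₁ b₂ → (1ᴰ ==′ g) ≡ b₀ → 1ᴰ ~ g ≡ b₁ → distIs′ 1ᴰ g 2 ≡ b₂ →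
        commonNbrs n R T 1ᴰ g ≡
        (if b₀ then k else 0) + (if b₁ then lam else 0) + (if b₂ then mu else 0)
      by-cases true  true  _     e≡g e~g _
        with () ← trans (sym e~g) (trans (cong (1ᴰ ~_) (sym (==⇒≡ {1ᴰ} {g} e≡g))) 1ᴰ≁1ᴰ)
      by-cases true  false true  e≡g _   d₂
        with () ← trans (sym e≡g) (proj₁ (distIs-2-separated 1ᴰ g d₂))
      by-cases true  false false e≡g _   _  = begin
        commonNbrs n R T 1ᴰ g    ≡⟨ cong (commonNbrs n R T 1ᴰ) (==⇒≡ {1ᴰ} {g} e≡g) ⟨
        commonNbrs n R T 1ᴰ 1ᴰ   ≡⟨ countDic-cong (λ x → ∧-idem (1ᴰ ~ x)) ⟩
        countDic n (1ᴰ ~_)       ≡⟨ valency ⟩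
        k                        ≡⟨ trans (ℕₚ.+-identityʳ _) (ℕₚ.+-identityʳ k) ⟨
        k + 0 + 0                ∎
        where open ≡-Reasoning
      by-cases false true  true  _   e~g d₂
        with () ← trans (sym e~g) (proj₂ (distIs-2-separated 1ᴰ g d₂))
      by-cases false true  false _   e~g _  = trans (λ-common 1ᴰ g e~g) (sym (ℕₚ.+-identityʳ lam))
      by-cases false false true  _   _   d₂ = μ-common 1ᴰ g d₂
      by-cases false false false e≢g e≁g d₂ = countDic-false _ λ x →
        ¬-not λ common → contradiction (trans (sym d₂) (common-neighbour⇒distIs-2 g x e≢g e≁g common)) λ ()

module RingFacts {c ℓ} (A : CommutativeRing c ℓ) where

  open CommutativeRing A
  open RingOps A
  open import Algebra.Properties.Semiring.Sum semiring
    using (sum; sum-cong-≋; sum-replicate-zero; ∑-distrib-+; ∑-comm; *-distribˡ-sum; *-distribʳ-sum)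
  open import Algebra.Properties.Semiring.Exp semiring using (_^_)
  import Algebra.Properties.Monoid.Mult +-monoid as Mult
  open import Algebra.Properties.Group +-group using (∙-cancelˡ)
  open import Relation.Binary.Reasoning.Setoid setoid

  ∑≡sum : ∀ {m} (f : Fin m → Carrier) → ∑ f ≡ sum f
  ∑≡sum {zero}  f = ≡.refl
  ∑≡sum {suc m} f = ≡.cong (f fzero +_) (∑≡sum (f ∘ fsuc))

  pow≡^ : ∀ x m → pow x m ≡ x ^ m
  pow≡^ x zero    = ≡.refl
  pow≡^ x (suc m) = ≡.cong (x *_) (pow≡^ x m)

  ι≡×1# : ∀ m → ι m ≡ m Mult.× 1#
  ι≡×1# zero    = ≡.refl
  ι≡×1# (suc m) = ≡.cong (1# +_) (ι≡×1# m)

  ι-homo-+ : ∀ a b → ι (a ℕ.+ b) ≈ ι a + ι b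
  ι-homo-+ a b = begin
    ι (a ℕ.+ b)                  ≡⟨ ι≡×1# (a ℕ.+ b) ⟩
    (a ℕ.+ b) Mult.× 1#          ≈⟨ Mult.×-homo-+ 1# a b ⟩
    a Mult.× 1# + b Mult.× 1#    ≡⟨ ≡.cong₂ _+_ (ι≡×1# a) (ι≡×1# b) ⟨
    ι a + ι b                    ∎

  1^≈1 : ∀ m → 1# ^ m ≈ 1#
  1^≈1 zero    = refl
  1^≈1 (suc m) = trans (*-identityˡ _) (1^≈1 m)

  ⟦_⟧_ : Bool → Carrier → Carrier
  ⟦ b ⟧ x = if b then x else 0#

  ⟦⟧-cong : ∀ b {x y} → x ≈ y → ⟦ b ⟧ x ≈ ⟦ b ⟧ y
  ⟦⟧-cong true  x≈y = x≈y
  ⟦⟧-cong false _   = refl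

  ⟦⟧-*ˡ : ∀ b x y → x * ⟦ b ⟧ y ≈ ⟦ b ⟧ (x * y)
  ⟦⟧-*ˡ true  x y = refl
  ⟦⟧-*ˡ false x y = zeroʳ x

  ⟦⟧-*ʳ : ∀ b x y → ⟦ b ⟧ x * y ≈ ⟦ b ⟧ (x * y)
  ⟦⟧-*ʳ true  x y = refl
  ⟦⟧-*ʳ false x y = zeroˡ y

  ⟦∧⟧ : ∀ b b′ x → ⟦ b ∧ b′ ⟧ x ≡ ⟦ b ⟧ (⟦ b′ ⟧ x)
  ⟦∧⟧ true  b′ x = ≡.refl
  ⟦∧⟧ false b′ x = ≡.refl

  ι-if-* : ∀ b m y → ι (if b then m else 0) * y ≈ ι m * ⟦ b ⟧ y
  ι-if-* true  m y = refl
  ι-if-* false m y = trans (zeroˡ y) (sym (zeroʳ (ι m)))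

  sum-⟦⟧ : ∀ {m} b (f : Fin m → Carrier) → sum (λ i → ⟦ b ⟧ f i) ≈ ⟦ b ⟧ sum f
  sum-⟦⟧ {m} true  f = refl
  sum-⟦⟧ {m} false f = sum-replicate-zero m

  sum-⟦⟧-*ˡ : ∀ {m} (P : Fin m → Bool) x (f : Fin m → Carrier) →
              sum (λ i → ⟦ P i ⟧ (x * f i)) ≈ x * sum (λ i → ⟦ P i ⟧ f i)
  sum-⟦⟧-*ˡ P x f = sym (trans (*-distribˡ-sum x (λ i → ⟦ P i ⟧ f i)) (sum-cong-≋ (λ i → ⟦⟧-*ˡ (P i) x (f i))))

  sum-⟦⟧-*ʳ : ∀ {m} (P : Fin m → Bool) x (f : Fin m → Carrier) →
              sum (λ i → ⟦ P i ⟧ (f i * x)) ≈ sum (λ i → ⟦ P i ⟧ f i) * x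
  sum-⟦⟧-*ʳ P x f = sym (trans (*-distribʳ-sum x (λ i → ⟦ P i ⟧ f i)) (sum-cong-≋ (λ i → ⟦⟧-*ʳ (P i) (f i) x)))

  sum-linear₃ : ∀ {m} x y z (f g h : Fin m → Carrier) →
                sum (λ i → x * f i + y * g i + z * h i) ≈ x * sum f + y * sum g + z * sum h
  sum-linear₃ x y z f g h = begin
    sum (λ i → x * f i + y * g i + z * h i)
      ≈⟨ ∑-distrib-+ (λ i → x * f i + y * g i) (λ i → z * h i) ⟩
    sum (λ i → x * f i + y * g i) + sum (λ i → z * h i)
      ≈⟨ +-congʳ (∑-distrib-+ (λ i → x * f i) (λ i → y * g i)) ⟩
    sum (λ i → x * f i) + sum (λ i → y * g i) + sum (λ i → z * h i)
      ≈⟨ +-cong (+-cong (*-distribˡ-sum x f) (*-distribˡ-sum y g)) (*-distribˡ-sum z h) ⟨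
    x * sum f + y * sum g + z * sum h ∎

  sum-comm-⟦⟧ : ∀ {m k} (P : Fin m → Bool) (f : Fin m → Fin k → Carrier) →
                sum (λ j → sum (λ i → ⟦ P i ⟧ f i j)) ≈ sum (λ i → ⟦ P i ⟧ sum (f i))
  sum-comm-⟦⟧ P f = trans (∑-comm (λ j i → ⟦ P i ⟧ f i j)) (sum-cong-≋ (λ i → sum-⟦⟧ (P i) (f i)))

  sum-point : ∀ {m} (i₀ : Fin m) (f : Fin m → Carrier) → sum (λ i → ⟦ ⌊ i₀ F.≟ i ⌋ ⟧ f i) ≈ f i₀
  sum-point {suc m} fzero f = trans (+-congˡ (sum-replicate-zero m)) (+-identityʳ _)
  sum-point {suc m} (fsuc i₀) f = trans (+-identityˡ _) (trans (sum-cong-≋ shift) (sum-point i₀ (f ∘ fsuc)))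
    where
    shift : ∀ i → ⟦ ⌊ fsuc i₀ F.≟ fsuc i ⌋ ⟧ f (fsuc i) ≈ ⟦ ⌊ i₀ F.≟ i ⌋ ⟧ f (fsuc i)
    shift i with i₀ F.≟ i
    ... | yes _ = refl
    ... | no  _ = refl

  -- countFin belongs to the ℤ_{2n} module of Defs, hence the irrelevant modulus n.
  countFin-scaled : ∀ n .{{_ : NonZero n}} {m} (f : Fin m → Bool) y → ι (countFin n f) * y ≈ sum (λ i → ⟦ f i ⟧ y)
  countFin-scaled n {zero}  f y = zeroˡ y
  countFin-scaled n {suc m} f y with f fzero
  ... | true  = trans (distribʳ _ _ _) (+-cong (*-identityˡ y) (countFin-scaled n (f ∘ fsuc) y))
  ... | false = trans (countFin-scaled n (f ∘ fsuc) y) (sym (+-identityˡ _))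

  countDic-scaled : ∀ n .{{_ : NonZero n}} (P : Dic n → Bool) y →
    ι (countDic n P) * y ≈ sum (λ a → ⟦ P (a , false) ⟧ y) + sum (λ a → ⟦ P (a , true) ⟧ y)
  countDic-scaled n P y = begin
    ι (countFin n P₀ ℕ.+ countFin n P₁) * y              ≈⟨ *-congʳ (ι-homo-+ (countFin n P₀) (countFin n P₁)) ⟩
    (ι (countFin n P₀) + ι (countFin n P₁)) * y         ≈⟨ distribʳ y _ _ ⟩
    ι (countFin n P₀) * y + ι (countFin n P₁) * y       ≈⟨ +-cong (countFin-scaled n P₀ y) (countFin-scaled n P₁ y) ⟩
    sum (λ a → ⟦ P₀ a ⟧ y) + sum (λ a → ⟦ P₁ a ⟧ y)     ∎
    where
    P₀ P₁ : Zm n → Bool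
    P₀ a = P (a , false)
    P₁ a = P (a , true)

  module Conjugation {ω : Carrier} {cj : Carrier → Carrier} (conj : IsConj ω cj) where
    open IsConj conj

    cj-0# : cj 0# ≈ 0#
    cj-0# = ∙-cancelˡ (cj 0#) _ _ (begin
      cj 0# + cj 0#   ≈⟨ cj-+ 0# 0# ⟨
      cj (0# + 0#)    ≈⟨ cong-cj (+-identityʳ 0#) ⟩
      cj 0#           ≈⟨ +-identityʳ _ ⟨
      cj 0# + 0#      ∎)

    cj-^ : ∀ x m → cj (x ^ m) ≈ cj x ^ m
    cj-^ x zero    = cj-1
    cj-^ x (suc m) = trans (cj-* x _) (*-congˡ (cj-^ x m))

    cj-⟦⟧ : ∀ b x → cj (⟦ b ⟧ x) ≈ ⟦ b ⟧ cj x
    cj-⟦⟧ true  x = refl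
    cj-⟦⟧ false x = cj-0#

    cj-sum : ∀ {m} (f : Fin m → Carrier) → cj (sum f) ≈ sum (cj ∘ f)
    cj-sum {zero}  f = cj-0#
    cj-sum {suc m} f = trans (cj-+ _ _) (+-congˡ (cj-sum (f ∘ fsuc)))

module Characters {c ℓ} (A : CommutativeRing c ℓ) (n : ℕ) .{{_ : NonZero n}}
  {ω : CommutativeRing.Carrier A} {cj : CommutativeRing.Carrier A → CommutativeRing.Carrier A}
  (ω^2n≈1 : CommutativeRing._≈_ A (RingOps.pow A ω (2 ℕ.* n)) (CommutativeRing.1# A))
  (conj : RingOps.IsConj A ω cj) (z : Zm n) where

  open CommutativeRing A
  open RingOps A using (IsConj)
  open RingFacts A
  open Conjugation conj
  open IsConj conj
  open ℤ-Mod n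
  open import Algebra.Properties.Semiring.Sum semiring
    using (sum; sum-cong-≋; ∑-permute; *-distribʳ-sum)
  open import Algebra.Properties.CommutativeSemiring.Exp commutativeSemiring
    using (_^_; ^-homo-*; ^-distrib-*; ^-congˡ; ^-assocʳ)
  open import Data.Fin.Permutation using (permutation)
  open import Relation.Binary.Reasoning.Setoid setoid

  χ : Zm n → Carrier
  χ a = ω ^ (toℕ a ℕ.* toℕ z)

  ω^N≈1 : ω ^ N ≈ 1#
  ω^N≈1 = trans (reflexive (≡.sym (pow≡^ ω N))) ω^2n≈1

  ω^m≈ω^[m%N] : ∀ m → ω ^ m ≈ ω ^ (m % N)
  ω^m≈ω^[m%N] m = begin
    ω ^ m                               ≡⟨ ≡.cong (ω ^_) (m≡m%n+[m/n]*n m N) ⟩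
    ω ^ (m % N ℕ.+ (m / N) ℕ.* N)       ≈⟨ ^-homo-* ω (m % N) _ ⟩
    ω ^ (m % N) * ω ^ ((m / N) ℕ.* N)   ≡⟨ ≡.cong (λ e → ω ^ (m % N) * ω ^ e) (ℕₚ.*-comm (m / N) N) ⟩
    ω ^ (m % N) * ω ^ (N ℕ.* (m / N))   ≈⟨ *-congˡ (^-assocʳ ω N (m / N)) ⟨
    ω ^ (m % N) * (ω ^ N) ^ (m / N)     ≈⟨ *-congˡ (trans (^-congˡ (m / N) ω^N≈1) (1^≈1 (m / N))) ⟩
    ω ^ (m % N) * 1#                    ≈⟨ *-identityʳ _ ⟩
    ω ^ (m % N)                         ∎

  ω^-cong-mod : ∀ {m m′} → m % N ≡ m′ % N → ω ^ m ≈ ω ^ m′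
  ω^-cong-mod {m} {m′} eq = trans (ω^m≈ω^[m%N] m) (trans (reflexive (≡.cong (ω ^_) eq)) (sym (ω^m≈ω^[m%N] m′)))

  χ-homo : ∀ a b → χ (a ⊕′ b) ≈ χ a * χ b
  χ-homo a b = begin
    χ (a ⊕′ b)                              ≈⟨ ω^-cong-mod (≡.trans (≡.cong (λ u → (u ℕ.* toℕ z) % N) (toℕ-mod _ N))
                                                               ([m%d*n]%d≡[m*n]%d _ (toℕ z) N)) ⟩
    ω ^ ((toℕ a ℕ.+ toℕ b) ℕ.* toℕ z)      ≡⟨ ≡.cong (ω ^_) (ℕₚ.*-distribʳ-+ (toℕ z) (toℕ a) (toℕ b)) ⟩
    ω ^ (toℕ a ℕ.* toℕ z ℕ.+ toℕ b ℕ.* toℕ z) ≈⟨ ^-homo-* ω (toℕ a ℕ.* toℕ z) (toℕ b ℕ.* toℕ z) ⟩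
    χ a * χ b                               ∎

  χ-0ᶻ : χ (0ᶻ n) ≈ 1#
  χ-0ᶻ = reflexive (≡.cong (λ u → ω ^ (u ℕ.* toℕ z)) toℕ-0ᶻ)

  cj-χ*χ≈1 : ∀ a → cj (χ a) * χ a ≈ 1#
  cj-χ*χ≈1 a = begin
    cj (χ a) * χ a          ≈⟨ *-congʳ (cj-^ ω m) ⟩
    cj ω ^ m * ω ^ m        ≈⟨ ^-distrib-* (cj ω) ω m ⟨
    (cj ω * ω) ^ m          ≈⟨ ^-congˡ m cj-ω ⟩
    1# ^ m                  ≈⟨ 1^≈1 m ⟩
    1#                      ∎
    where m = toℕ a ℕ.* toℕ z

  χ-⊖ : ∀ a → χ (⊖′ a) ≈ cj (χ a)
  χ-⊖ a = begin
    χ (⊖′ a)                        ≈⟨ *-identityˡ _ ⟨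
    1# * χ (⊖′ a)                   ≈⟨ *-congʳ (cj-χ*χ≈1 a) ⟨
    (cj (χ a) * χ a) * χ (⊖′ a)     ≈⟨ *-assoc _ _ _ ⟩
    cj (χ a) * (χ a * χ (⊖′ a))     ≈⟨ *-congˡ (χ-homo a (⊖′ a)) ⟨
    cj (χ a) * χ (a ⊕′ (⊖′ a))      ≡⟨ ≡.cong (λ u → cj (χ a) * χ u) (⊖-inverseʳ a) ⟩
    cj (χ a) * χ (0ᶻ n)             ≈⟨ *-congˡ χ-0ᶻ ⟩
    cj (χ a) * 1#                   ≈⟨ *-identityʳ _ ⟩
    cj (χ a)                        ∎

  charSum : (Zm n → Bool) → Carrier
  charSum Q = sum λ a → ⟦ Q a ⟧ χ a

  charSum-cong : ∀ {P Q} → (∀ a → P a ≡ Q a) → charSum P ≈ charSum Q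
  charSum-cong P≗Q = sum-cong-≋ λ a → reflexive (≡.cong (λ b → ⟦ b ⟧ χ a) (P≗Q a))

  ∑-pow≈charSum : ∀ Q → RingOps.∑ A (λ a → ⟦ Q a ⟧ RingOps.pow A ω (toℕ a ℕ.* toℕ z)) ≈ charSum Q
  ∑-pow≈charSum Q = trans (reflexive (∑≡sum (λ a → ⟦ Q a ⟧ RingOps.pow A ω (toℕ a ℕ.* toℕ z))))
    (sum-cong-≋ λ a → reflexive (≡.cong (λ x → ⟦ Q a ⟧ x) (pow≡^ ω (toℕ a ℕ.* toℕ z))))

  charSum-translate : ∀ Q a → charSum (λ c → Q (c ⊝′ a)) ≈ charSum Q * χ a
  charSum-translate Q a = begin
    charSum (λ c → Q (c ⊝′ a))
      ≈⟨ ∑-permute _ (permutation (_⊕′ a) (_⊝′ a) (//-rightDividesˡ a) (//-rightDividesʳ a)) ⟩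
    sum (λ b → ⟦ Q ((b ⊕′ a) ⊝′ a) ⟧ χ (b ⊕′ a))
      ≈⟨ sum-cong-≋ (λ b → reflexive (≡.cong (λ u → ⟦ Q u ⟧ χ (b ⊕′ a)) (//-rightDividesʳ a b))) ⟩
    sum (λ b → ⟦ Q b ⟧ χ (b ⊕′ a))
      ≈⟨ sum-cong-≋ (λ b → trans (⟦⟧-cong (Q b) (χ-homo b a)) (sym (⟦⟧-*ʳ (Q b) (χ b) (χ a)))) ⟩
    sum (λ b → ⟦ Q b ⟧ χ b * χ a)
      ≈⟨ *-distribʳ-sum (χ a) (λ b → ⟦ Q b ⟧ χ b) ⟨
    charSum Q * χ a ∎

  charSum-reflect : ∀ Q a → charSum (λ c → Q (a ⊝′ c)) ≈ χ a * cj (charSum Q)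
  charSum-reflect Q a = begin
    charSum (λ c → Q (a ⊝′ c))
      ≈⟨ ∑-permute _ (permutation (a ⊝′_) (a ⊝′_) (⊝-⊝-cancel a) (⊝-⊝-cancel a)) ⟩
    sum (λ b → ⟦ Q (a ⊝′ (a ⊝′ b)) ⟧ χ (a ⊝′ b))
      ≈⟨ sum-cong-≋ (λ b → reflexive (≡.cong (λ u → ⟦ Q u ⟧ χ (a ⊝′ b)) (⊝-⊝-cancel a b))) ⟩
    sum (λ b → ⟦ Q b ⟧ χ (a ⊝′ b))
      ≈⟨ sum-cong-≋ (λ b → ⟦⟧-cong (Q b) (trans (χ-homo a (⊖′ b)) (*-congˡ (χ-⊖ b)))) ⟩
    sum (λ b → ⟦ Q b ⟧ (χ a * cj (χ b)))
      ≈⟨ sum-⟦⟧-*ˡ Q (χ a) (cj ∘ χ) ⟩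
    χ a * sum (λ b → ⟦ Q b ⟧ cj (χ b))
      ≈⟨ *-congˡ (sum-cong-≋ (λ b → cj-⟦⟧ (Q b) (χ b))) ⟨
    χ a * sum (λ b → cj (⟦ Q b ⟧ χ b))
      ≈⟨ *-congˡ (cj-sum (λ b → ⟦ Q b ⟧ χ b)) ⟨
    χ a * cj (charSum Q) ∎

module CommonNeighbourSums {c ℓ} (A : CommutativeRing c ℓ) (n : ℕ) .{{_ : NonZero n}} (R T : Subset (2 ℕ.* n))
  (0∉R : lookup R (0ᶻ n) ≡ false)
  (R-sym : ∀ i → lookup R (⊖_ n i) ≡ lookup R i)
  (T-shift : ∀ i → lookup T (_⊕_ n (nᶻ n) i) ≡ lookup T i)
  {ω : CommutativeRing.Carrier A} {cj : CommutativeRing.Carrier A → CommutativeRing.Carrier A}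
  (ω^2n≈1 : CommutativeRing._≈_ A (RingOps.pow A ω (2 ℕ.* n)) (CommutativeRing.1# A))
  (conj : RingOps.IsConj A ω cj) (z : Zm n) where

  open CommutativeRing A
  open RingOps A using (ι)
  open RingFacts A
  open ℤ-Mod n using (N)
  open DicEnumeration n using (_==′_)
  open CayleyGraph n R T 0∉R R-sym T-shift
  open Characters A n ω^2n≈1 conj z
  open import Algebra.Properties.Semiring.Sum semiring using (sum; sum-cong-≋; sum-replicate-zero; ∑-distrib-+)
  open import Relation.Binary.Reasoning.Setoid setoid

  commonNbrs-1ᴰ-scaled : ∀ g y → ι (commonNbrs n R T 1ᴰ g) * y ≈
    sum (λ a → ⟦ lookup R a ⟧ ⟦ (a , false) ~ g ⟧ y) + sum (λ a → ⟦ lookup T a ⟧ ⟦ (a , true) ~ g ⟧ y)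
  commonNbrs-1ᴰ-scaled g y = trans (countDic-scaled n (λ x → 1ᴰ ~ x ∧ g ~ x) y)
    (+-cong (sum-cong-≋ (pointwise false (lookup R) 1ᴰ~-f)) (sum-cong-≋ (pointwise true (lookup T) 1ᴰ~-t)))
    where
    pointwise : ∀ δ (S : Zm n → Bool) → (∀ a → 1ᴰ ~ (a , δ) ≡ S a) → ∀ a →
                ⟦ 1ᴰ ~ (a , δ) ∧ g ~ (a , δ) ⟧ y ≈ ⟦ S a ⟧ ⟦ (a , δ) ~ g ⟧ y
    pointwise δ S 1ᴰ~≗S a = reflexive (≡.trans (⟦∧⟧ (1ᴰ ~ (a , δ)) (g ~ (a , δ)) y)
      (≡.cong₂ (λ b b′ → ⟦ b ⟧ ⟦ b′ ⟧ y) (1ᴰ~≗S a) (~-sym g (a , δ))))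

  commonNbrsSum : Bool → Carrier
  commonNbrsSum ε = sum λ c → ι (commonNbrs n R T 1ᴰ (c , ε)) * χ c

  commonNbrsSum-convolution : ∀ ε → commonNbrsSum ε ≈
    sum (λ a → ⟦ lookup R a ⟧ charSum (λ c → (a , false) ~ (c , ε))) +
    sum (λ a → ⟦ lookup T a ⟧ charSum (λ c → (a , true) ~ (c , ε)))
  commonNbrsSum-convolution ε = begin
    commonNbrsSum ε
      ≈⟨ sum-cong-≋ (λ c → commonNbrs-1ᴰ-scaled (c , ε) (χ c)) ⟩
    sum (λ c → sum (λ a → ⟦ lookup R a ⟧ F a c) + sum (λ a → ⟦ lookup T a ⟧ G a c))
      ≈⟨ ∑-distrib-+ (λ c → sum (λ a → ⟦ lookup R a ⟧ F a c)) (λ c → sum (λ a → ⟦ lookup T a ⟧ G a c)) ⟩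
    sum (λ c → sum (λ a → ⟦ lookup R a ⟧ F a c)) + sum (λ c → sum (λ a → ⟦ lookup T a ⟧ G a c))
      ≈⟨ +-cong (sum-comm-⟦⟧ (lookup R) F) (sum-comm-⟦⟧ (lookup T) G) ⟩
    sum (λ a → ⟦ lookup R a ⟧ sum (F a)) + sum (λ a → ⟦ lookup T a ⟧ sum (G a)) ∎
    where
    F G : Zm n → Zm n → Carrier
    F a c = ⟦ (a , false) ~ (c , ε) ⟧ χ c
    G a c = ⟦ (a , true) ~ (c , ε) ⟧ χ c

  r t : Carrier
  r = charSum (lookup R)
  t = charSum (lookup T)

  commonNbrsSum-false≈r*r+t*cj[t] : commonNbrsSum false ≈ r * r + t * cj t
  commonNbrsSum-false≈r*r+t*cj[t] = begin
    commonNbrsSum false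
      ≈⟨ commonNbrsSum-convolution false ⟩
    sum (λ a → ⟦ lookup R a ⟧ charSum (λ c → (a , false) ~ (c , false))) +
    sum (λ a → ⟦ lookup T a ⟧ charSum (λ c → (a , true) ~ (c , false)))
      ≈⟨ +-cong (sum-cong-≋ λ a → ⟦⟧-cong (lookup R a) (trans (charSum-cong (~-ff a)) (charSum-translate (lookup R) a)))
                (sum-cong-≋ λ a → ⟦⟧-cong (lookup T a) (trans (charSum-cong (~-tf a)) (charSum-reflect (lookup T) a))) ⟩
    sum (λ a → ⟦ lookup R a ⟧ (r * χ a)) + sum (λ a → ⟦ lookup T a ⟧ (χ a * cj t))
      ≈⟨ +-cong (sum-⟦⟧-*ˡ (lookup R) r χ) (sum-⟦⟧-*ʳ (lookup T) (cj t) χ) ⟩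
    r * r + t * cj t ∎

  commonNbrsSum-true≈t*r+r*t : commonNbrsSum true ≈ t * r + r * t
  commonNbrsSum-true≈t*r+r*t = begin
    commonNbrsSum true
      ≈⟨ commonNbrsSum-convolution true ⟩
    sum (λ a → ⟦ lookup R a ⟧ charSum (λ c → (a , false) ~ (c , true))) +
    sum (λ a → ⟦ lookup T a ⟧ charSum (λ c → (a , true) ~ (c , true)))
      ≈⟨ +-cong (sum-cong-≋ λ a → ⟦⟧-cong (lookup R a) (trans (charSum-cong (~-ft a)) (charSum-translate (lookup T) a)))
                (sum-cong-≋ λ a → ⟦⟧-cong (lookup T a) (trans (charSum-cong (~-tt a)) (charSum-translate (lookup R) a))) ⟩
    sum (λ a → ⟦ lookup R a ⟧ (t * χ a)) + sum (λ a → ⟦ lookup T a ⟧ (r * χ a))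
      ≈⟨ +-cong (sum-⟦⟧-*ˡ (lookup R) t χ) (sum-⟦⟧-*ˡ (lookup T) r χ) ⟩
    t * r + r * t ∎

  charSum-1ᴰ==-false : charSum (λ c → 1ᴰ ==′ (c , false)) ≈ 1#
  charSum-1ᴰ==-false = begin
    charSum (λ c → 1ᴰ ==′ (c , false))   ≈⟨ charSum-cong (λ c → ∧-identityʳ _) ⟩
    charSum (λ c → ⌊ 0ᶻ n F.≟ c ⌋)       ≈⟨ sum-point (0ᶻ n) χ ⟩
    χ (0ᶻ n)                             ≈⟨ χ-0ᶻ ⟩
    1#                                   ∎

  charSum-1ᴰ==-true : charSum (λ c → 1ᴰ ==′ (c , true)) ≈ 0#
  charSum-1ᴰ==-true = trans (charSum-cong (λ c → ∧-zeroʳ _)) (sum-replicate-zero N)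

  module _ (k lam mu : ℕ)
    (valency : countDic n (1ᴰ ~_) ≡ k)
    (λ-common : ∀ u v → u ~ v ≡ true → commonNbrs n R T u v ≡ lam)
    (μ-common : ∀ u v → Dist n R T u v 2 → commonNbrs n R T u v ≡ mu) where

    commonNbrs-1ᴰ-weighted : ∀ g y → ι (commonNbrs n R T 1ᴰ g) * y ≈
      ι k * ⟦ 1ᴰ ==′ g ⟧ y + ι lam * ⟦ 1ᴰ ~ g ⟧ y + ι mu * ⟦ distIs′ 1ᴰ g 2 ⟧ y
    commonNbrs-1ᴰ-weighted g y = begin
      ι (commonNbrs n R T 1ᴰ g) * y   ≡⟨ ≡.cong (λ m → ι m * y) (commonNbrs-1ᴰ k lam mu valency λ-common μ-common g) ⟩
      ι (K ℕ.+ L ℕ.+ M) * y           ≈⟨ *-congʳ (trans (ι-homo-+ (K ℕ.+ L) M) (+-congʳ (ι-homo-+ K L))) ⟩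
      (ι K + ι L + ι M) * y           ≈⟨ trans (distribʳ y _ _) (+-congʳ (distribʳ y _ _)) ⟩
      ι K * y + ι L * y + ι M * y     ≈⟨ +-cong (+-cong (ι-if-* _ k y) (ι-if-* _ lam y)) (ι-if-* _ mu y) ⟩
      ι k * ⟦ 1ᴰ ==′ g ⟧ y + ι lam * ⟦ 1ᴰ ~ g ⟧ y + ι mu * ⟦ distIs′ 1ᴰ g 2 ⟧ y ∎
      where
      K L M : ℕ
      K = if 1ᴰ ==′ g then k else 0
      L = if 1ᴰ ~ g then lam else 0
      M = if distIs′ 1ᴰ g 2 then mu else 0

    commonNbrsSum-weighted : ∀ ε → commonNbrsSum ε ≈
      ι k * charSum (λ c → 1ᴰ ==′ (c , ε)) + ι lam * charSum (λ c → 1ᴰ ~ (c , ε)) +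
      ι mu * charSum (λ c → distIs′ 1ᴰ (c , ε) 2)
    commonNbrsSum-weighted ε = trans (sum-cong-≋ (λ c → commonNbrs-1ᴰ-weighted (c , ε) (χ c)))
      (sum-linear₃ (ι k) (ι lam) (ι mu)
        (λ c → ⟦ 1ᴰ ==′ (c , ε) ⟧ χ c) (λ c → ⟦ 1ᴰ ~ (c , ε) ⟧ χ c) (λ c → ⟦ distIs′ 1ᴰ (c , ε) 2 ⟧ χ c))

    r*r+t*cj[t]≈k+λr+μr₂ : r * r + t * cj t ≈ ι k + ι lam * r + ι mu * charSum (inRj n R T 2)
    r*r+t*cj[t]≈k+λr+μr₂ = begin
      r * r + t * cj t
        ≈⟨ commonNbrsSum-false≈r*r+t*cj[t] ⟨
      commonNbrsSum false
        ≈⟨ commonNbrsSum-weighted false ⟩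
      ι k * charSum (λ c → 1ᴰ ==′ (c , false)) + ι lam * charSum (λ c → 1ᴰ ~ (c , false)) + ι mu * charSum (inRj n R T 2)
        ≈⟨ +-congʳ (+-cong (trans (*-congˡ charSum-1ᴰ==-false) (*-identityʳ (ι k))) (*-congˡ (charSum-cong 1ᴰ~-f))) ⟩
      ι k + ι lam * r + ι mu * charSum (inRj n R T 2) ∎

    2rt≈λt+μt₂ : ι 2 * r * t ≈ ι lam * t + ι mu * charSum (inTj n R T 2)
    2rt≈λt+μt₂ = begin
      ι 2 * r * t
        ≈⟨ *-congʳ (*-congʳ (+-congˡ (+-identityʳ 1#))) ⟩
      (1# + 1#) * r * t
        ≈⟨ *-congʳ (trans (distribʳ r 1# 1#) (+-cong (*-identityˡ r) (*-identityˡ r))) ⟩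
      (r + r) * t
        ≈⟨ trans (distribʳ t r r) (+-congʳ (*-comm r t)) ⟩
      t * r + r * t
        ≈⟨ commonNbrsSum-true≈t*r+r*t ⟨
      commonNbrsSum true
        ≈⟨ commonNbrsSum-weighted true ⟩
      ι k * charSum (λ c → 1ᴰ ==′ (c , true)) + ι lam * charSum (λ c → 1ᴰ ~ (c , true)) + ι mu * charSum (inTj n R T 2)
        ≈⟨ +-congʳ (+-cong (trans (*-congˡ charSum-1ᴰ==-true) (zeroʳ (ι k))) (*-congˡ (charSum-cong 1ᴰ~-t))) ⟩
      0# + ι lam * t + ι mu * charSum (inTj n R T 2)
        ≈⟨ +-congʳ (+-identityˡ _) ⟩
      ι lam * t + ι mu * charSum (inTj n R T 2) ∎

  r₁≈r : RingOps.rf A n R T ω 1 z ≈ r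
  r₁≈r = trans (∑-pow≈charSum (inRj n R T 1)) (charSum-cong λ c → ≡.trans (distIs-1 (c , false)) (1ᴰ~-f c))

  t₁≈t : RingOps.tf A n R T ω 1 z ≈ t
  t₁≈t = trans (∑-pow≈charSum (inTj n R T 1)) (charSum-cong λ c → ≡.trans (distIs-1 (c , true)) (1ᴰ~-t c))

lemma3p5 : ∀ {c ℓ : Level} (A : CommutativeRing c ℓ)
  (n : ℕ) .{{_ : NonZero n}} (R T : Subset (2 ℕ.* n)) →
  -- 0 ∉ R,  R = -R,  T = n + T
  lookup R (0ᶻ n) ≡ false →
  (∀ i → lookup R (⊖_ n i) ≡ lookup R i) →
  (∀ i → lookup T (_⊕_ n (nᶻ n) i) ≡ lookup T i) →
  DistanceRegular n R T →
  (k lam mu : ℕ) →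
  -- k is the valency, lam = λ, mu = μ
  countDic n (adj n R T (e n)) ≡ k →
  (∀ u v → adj n R T u v ≡ true → commonNbrs n R T u v ≡ lam) →
  (∀ u v → Dist n R T u v 2 → commonNbrs n R T u v ≡ mu) →
  -- ω a primitive 2n-th root of unity, cj complex conjugation
  (ω : CommutativeRing.Carrier A) → (cj : CommutativeRing.Carrier A → CommutativeRing.Carrier A) →
  RingOps.PrimitiveRoot A (2 ℕ.* n) ω →
  RingOps.IsConj A ω cj →
  ∀ (z : Fin (2 ℕ.* n)) →
    let open CommutativeRing A
        open RingOps A
        r  = rf n R T ω 1 z
        t  = tf n R T ω 1 z
        r₂ = rf n R T ω 2 z
        t₂ = tf n R T ω 2 z
    in (r * r + t * cj t ≈ ι k + ι lam * r + ι mu * r₂)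
       × (ι 2 * r * t ≈ ι lam * t + ι mu * t₂)
-- Distance-regularity is used only through λ and μ, and of primitivity only ω^{2n} = 1.
lemma3p5 A n R T 0∉R R-sym T-shift _ k lam mu valency λ-common μ-common ω cj (ω^2n≈1 , _) conj z =
  first , second
  where
  open CommutativeRing A
  open RingOps A using (rf; tf; ι; IsConj)
  open CommonNeighbourSums A n R T 0∉R R-sym T-shift ω^2n≈1 conj z
  open Characters A n ω^2n≈1 conj z using (charSum; ∑-pow≈charSum)
  open import Relation.Binary.Reasoning.Setoid setoid

  r₁ t₁ : Carrier
  r₁ = rf n R T ω 1 z
  t₁ = tf n R T ω 1 z

  first : r₁ * r₁ + t₁ * cj t₁ ≈ ι k + ι lam * r₁ + ι mu * rf n R T ω 2 z
  first = begin
    r₁ * r₁ + t₁ * cj t₁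
      ≈⟨ +-cong (*-cong r₁≈r r₁≈r) (*-cong t₁≈t (IsConj.cong-cj conj t₁≈t)) ⟩
    r * r + t * cj t
      ≈⟨ r*r+t*cj[t]≈k+λr+μr₂ k lam mu valency λ-common μ-common ⟩
    ι k + ι lam * r + ι mu * charSum (inRj n R T 2)
      ≈⟨ +-cong (+-congˡ (*-congˡ r₁≈r)) (*-congˡ (∑-pow≈charSum (inRj n R T 2))) ⟨
    ι k + ι lam * r₁ + ι mu * rf n R T ω 2 z ∎

  second : ι 2 * r₁ * t₁ ≈ ι lam * t₁ + ι mu * tf n R T ω 2 z
  second = begin
    ι 2 * r₁ * t₁
      ≈⟨ *-cong (*-congˡ r₁≈r) t₁≈t ⟩
    ι 2 * r * t
      ≈⟨ 2rt≈λt+μt₂ k lam mu valency λ-common μ-common ⟩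
    ι lam * t + ι mu * charSum (inTj n R T 2)
      ≈⟨ +-cong (*-congˡ t₁≈t) (*-congˡ (∑-pow≈charSum (inTj n R T 2))) ⟨
    ι lam * t₁ + ι mu * tf n R T ω 2 z ∎
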